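{- Let $G=(V,E)$ be a finite directed simple graph without self-loops and let $\alpha\in\mathbb{C}$ be a root of unity. For every $g\in\mathbb{C}^{\vec E}$, $$\begin{pmatrix}(B_\alpha g)^{\mathrm{out}}_\alpha\\ (B_\alpha g)^{\mathrm{in}}_\alpha\end{pmatrix}=\begin{pmatrix}A_\alpha & -I\\ D-I & 0\end{pmatrix}\begin{pmatrix}g^{\mathrm{out}}_\alpha\\ g^{\mathrm{in}}_\alpha\end{pmatrix}.$$
   Context: The graph $G$ may contain both $(u,v)$ and $(v,u)$. Write $u\rightarrow_G v$ (equivalently $v\leftarrow_G u$) if $(u,v)\in E$ and $(v,u)\notin E$, and $u\leftrightarrow_G v$ if both are in $E$. Let $E_U=\{\{u,v\}:(u,v)\in E\text{ or }(v,u)\in E\}$, $m=|E_U|$, and let $\vec E$ be the set of $2m$ directed edges obtained by orienting each element of $E_U$ in both directions; $\overrightarrow{uv}\in\vec E$ denotes the one with initial vertex $u$ and terminal vertex $v$, and $i_e,t_e$ are the initial and terminal vertices of $e$. Neighborhoods: $\overleftarrow{N_u}=\{v:u\leftarrow_G v\}$, $\overrightarrow{N_u}=\{v:u\rightarrow_G v\}$, $\overleftrightarrow{N_u}=\{v:u\leftrightarrow_G v\}$, $N_u$ their union; $d_u=|N_u|$, $D=\mathrm{diag}(d_u)_{u\in V}$. The Hermitian adjacency matrix $A_\alpha\in\mathbb{C}^{V\times V}$ has $(A_\alpha)_{uv}=1$ if $u\leftrightarrow_G v$, $\alpha$ if $u\rightarrow_G v$, $\bar\alpha$ if $u\leftarrow_G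 v$, $0$ otherwise. The matrix $B\in\mathbb{R}^{\vec E\times\vec E}$ has $B_{ef}=1$ if $t_e=i_f$ and $i_e\neq t_f$, else $0$. For $e\in\vec E$ let $\lambda_e=1$ if $i_e\leftrightarrow_G t_e$, $\alpha$ if $i_e\rightarrow_G t_e$, $\bar\alpha$ if $i_e\leftarrow_G t_e$; $B_\alpha=B\,\mathrm{diag}(\lambda_e)_{e\in\vec E}$. For $g\in\mathbb{C}^{\vec E}$, the in-vector and out-vector $g^{\mathrm{in}}_\alpha,g^{\mathrm{out}}_\alpha\in\mathbb{C}^V$ are $(g^{\mathrm{in}}_\alpha)_u=\sum_{v\in N_u}g_{\overrightarrow{vu}}$ and $(g^{\mathrm{out}}_\alpha)_u=\sum_{v\in\overleftrightarrow{N_u}}g_{\overrightarrow{uv}}+\alpha\sum_{v\in\overrightarrow{N_u}}g_{\overrightarrow{uv}}+\bar\alpha\sum_{v\in\overleftarrow{N_u}}g_{\overrightarrow{uv}}$. -}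

module Defs where

open import Level using (Level)
open import Data.Nat using (ℕ; suc; _∸_)
open import Data.Fin using (Fin; _≟_)
open import Data.Bool using (Bool; true; false; if_then_else_; _∧_; _∨_; not)
open import Data.Product using ()
open import Relation.Nullary.Decidable using (⌊_⌋)
open import Relation.Binary.PropositionalEquality using (_≡_)
open import Algebra.Bundles using (CommutativeRing)
import Algebra.Properties.Monoid.Sum as MonoidSum
import Algebra.Definitions.RawMonoid as RM

-- A finite directed simple graph on the vertex set V = Fin N without self-loops.
-- The edge set E ⊆ V × V is given by its (decidable) indicator; (u,v) and (v,u)
-- may both be edges.
record Digraph (N : ℕ) : Set where
  field
    edge     : Fin N → Fin N → Bool
    loopless : ∀ u → edge u u ≡ false

-- multiplicative power x ^ n in a commutative ring
pow : ∀ {c ℓ} (R : CommutativeRing c ℓ) → CommutativeRing.Carrier R → ℕ → CommutativeRing.Carrier R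
pow R x n = n × x
  where open RM (CommutativeRing.*-rawMonoid R) using (_×_)

module Setup {c ℓ : Level} (R : CommutativeRing c ℓ) {N : ℕ} (G : Digraph N)
             (α : CommutativeRing.Carrier R) (k : ℕ) where
  -- k is an order witness for the root of unity α (α ^ k = 1, k ≥ 1); the
  -- complex conjugate of a root of unity is ᾱ = α⁻¹ = α ^ (k ∸ 1).
  open CommutativeRing R
  open Digraph G
  open MonoidSum +-monoid using (sum)

  V : Set
  V = Fin N

  ᾱ : Carrier
  ᾱ = pow R α (k ∸ 1)

  [_] : Bool → Carrier → Carrier
  [ b ] x = if b then x else 0#

  bi : V → V → Bool
  bi u v = edge u v ∧ edge v u
  to : V → V → Bool
  to u v = edge u v ∧ not (edge v u)
  from : V → V → Bool
  from u v = edge v u ∧ not (edge u v)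

  -- {u,v} ∈ E_U, i.e. v ∈ N_u, i.e. the directed edge uv belongs to E⃗
  adjU : V → V → Bool
  adjU u v = edge u v ∨ edge v u

  ∑ : (V → Carrier) → Carrier
  ∑ f = sum f

  -- vectors indexed by E⃗ are represented as functions on V × V, of which only
  -- the entries at pairs (u,v) with adjU u v = true are ever read.
  EVec : Set c
  EVec = V → V → Carrier

  ∑E : (V → V → Carrier) → Carrier
  ∑E f = ∑ λ x → ∑ λ w → [ adjU x w ] (f x w)

  Aα : V → V → Carrier
  Aα u v = if bi u v then 1# else if to u v then α else if from u v then ᾱ else 0#

  I : V → V → Carrier
  I u v = if ⌊ u ≟ v ⌋ then 1# else 0#

  deg : V → Carrier
  deg u = ∑ λ v → [ adjU u v ] 1#

  D : V → V → Carrier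
  D u v = if ⌊ u ≟ v ⌋ then deg u else 0#

  lam : V → V → Carrier
  lam u v = if bi u v then 1# else if to u v then α else ᾱ

  B : V → V → V → V → Carrier
  B u v x w = if ⌊ v ≟ x ⌋ ∧ not ⌊ u ≟ w ⌋ then 1# else 0#

  -- B_α = B diag(λ); (B_α g)_e = ∑_f B_{ef} λ_f g_f
  Bα· : EVec → EVec
  Bα· g u v = ∑E λ x w → B u v x w * (lam x w * g x w)

  gin : EVec → V → Carrier
  gin g u = ∑ λ v → [ adjU u v ] (g v u)

  gout : EVec → V → Carrier
  gout g u = (∑ λ v → [ bi u v ] (g u v))
           + (α * (∑ λ v → [ to u v ] (g u v))
           + ᾱ * (∑ λ v → [ from u v ] (g u v)))

  _·_ : (V → V → Carrier) → (V → Carrier) → V → Carrier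
  (M · x) u = ∑ λ v → M u v * x v

  negI : V → V → Carrier
  negI u v = - I u v

  D-I : V → V → Carrier
  D-I u v = D u v - I u v

  Z : V → V → Carrier
  Z u v = 0#

-- The row of B_α indexed by vu sums λ_{uw} g_{uw} over all w ∈ N_u except w = v, so
--   (B_α g)_{vu} = (g^out_α)_u − λ_{uv} g_{uv}.
-- Summing this over v ∈ N_u gives (d_u − 1) (g^out_α)_u, the second row.  For the
-- first row weight it by λ_{uv} and sum over v ∈ N_u: the first term gives
-- (A_α g^out_α)_u, and since λ_{uv} λ_{vu} = α ᾱ = 1 the second gives (g^in_α)_u.
module Submission where

open import Defs
open import Level using (Level)
open import Data.Nat using (ℕ; _≥_; suc; s≤s; z≤n)
open import Data.Product using (_×_; _,_)
open import Data.Bool using (Bool; true; false; if_then_else_; _∧_; _∨_; not)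
open import Data.Fin using (Fin; _≟_) renaming (zero to fzero; suc to fsuc)
open import Relation.Nullary.Decidable using (⌊_⌋; yes; no)
open import Relation.Binary.PropositionalEquality as ≡ using (_≡_; cong)
open import Algebra.Bundles using (CommutativeRing)

suc≟suc : ∀ {n} (u v : Fin n) → ⌊ fsuc u ≟ fsuc v ⌋ ≡ ⌊ u ≟ v ⌋
suc≟suc u v with u ≟ v
... | yes _ = ≡.refl
... | no _  = ≡.refl

module MaskedSums {c ℓ} (R : CommutativeRing c ℓ) where
  open CommutativeRing R
  open import Algebra.Properties.Semiring.Sum semiring
    using (sum; sum-cong-≋; sum-replicate-zero; ∑-distrib-+; *-distribˡ-sum; *-distribʳ-sum)
  open import Algebra.Properties.Ring ring
    using (-0#≈0#; -1*x≈-x; -‿distribʳ-*; //-rightDividesʳ)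
  open import Relation.Binary.Reasoning.Setoid setoid

  -- the masking operator Setup.[_], which does not depend on the graph
  [_] : Bool → Carrier → Carrier
  [ b ] x = if b then x else 0#

  []-cong : ∀ b {x y} → x ≈ y → [ b ] x ≈ [ b ] y
  []-cong true  x≈y = x≈y
  []-cong false _   = refl

  []-zero : ∀ b → [ b ] 0# ≈ 0#
  []-zero true  = refl
  []-zero false = refl

  []-*ˡ : ∀ b x y → [ b ] x * y ≈ [ b ] (x * y)
  []-*ˡ true  x y = refl
  []-*ˡ false x y = zeroˡ y

  -[] : ∀ b x → - [ b ] x ≈ [ b ] (- x)
  -[] true  x = refl
  -[] false x = -0#≈0#

  []-‿distrib : ∀ b x y → [ b ] (x - y) ≈ [ b ] x - [ b ] y
  []-‿distrib true  x y = refl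
  []-‿distrib false x y = sym (trans (+-congˡ -0#≈0#) (+-identityʳ 0#))

  []-sub-[] : ∀ b x y → [ b ] (x - [ b ] y) ≈ [ b ] x - [ b ] y
  []-sub-[] true  x y = refl
  []-sub-[] false x y = []-‿distrib false x y

  []-∧-* : ∀ a b c y → [ a ] ([ b ∧ c ] 1# * y) ≈ [ b ] ([ c ] ([ a ] y))
  []-∧-* a true  true  y = []-cong a (*-identityˡ y)
  []-∧-* a true  false y = trans ([]-cong a (zeroˡ y)) ([]-zero a)
  []-∧-* a false c     y = trans ([]-cong a (zeroˡ y)) ([]-zero a)

  []-split : ∀ b x → x ≈ [ not b ] x + [ b ] x
  []-split true  x = sym (+-identityˡ x)
  []-split false x = sym (+-identityʳ x)

  *-cancel-inverse : ∀ {x x′} X y → x * x′ ≈ 1# → x * (X - x′ * y) ≈ x * X - y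
  *-cancel-inverse {x} {x′} X y xx′≈1 = begin
    x * (X - x′ * y)         ≈⟨ distribˡ x X (- (x′ * y)) ⟩
    x * X + x * - (x′ * y)   ≈⟨ +-congˡ (-‿distribʳ-* x (x′ * y)) ⟨
    x * X - x * (x′ * y)     ≈⟨ +-congˡ (-‿cong (*-assoc x x′ y)) ⟨
    x * X - x * x′ * y       ≈⟨ +-congˡ (-‿cong (trans (*-congʳ xx′≈1) (*-identityˡ y))) ⟩
    x * X - y                ∎

  sum-neg : ∀ {n} (f : Fin n → Carrier) → sum (λ i → - f i) ≈ - sum f
  sum-neg {n} f = begin
    sum (λ i → - f i)        ≈⟨ sum-cong-≋ {n} (λ i → -1*x≈-x (f i)) ⟨
    sum (λ i → - 1# * f i)   ≈⟨ *-distribˡ-sum (- 1#) f ⟨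
    - 1# * sum f             ≈⟨ -1*x≈-x (sum f) ⟩
    - sum f                  ∎

  sum-sub : ∀ {n} (f g : Fin n → Carrier) → sum (λ i → f i - g i) ≈ sum f - sum g
  sum-sub f g = trans (∑-distrib-+ f (λ i → - g i)) (+-congˡ (sum-neg g))

  sum-[] : ∀ {n} b (f : Fin n → Carrier) → sum (λ i → [ b ] (f i)) ≈ [ b ] (sum f)
  sum-[] true      f = refl
  sum-[] {n} false f = sum-replicate-zero n

  sum-[]-const : ∀ {n} (a : Fin n → Bool) x →
                 sum (λ i → [ a i ] x) ≈ sum (λ i → [ a i ] 1#) * x
  sum-[]-const {n} a x = begin
    sum (λ i → [ a i ] x)        ≈⟨ sum-cong-≋ {n} (λ i → []-cong (a i) (*-identityˡ x)) ⟨
    sum (λ i → [ a i ] (1# * x)) ≈⟨ sum-cong-≋ {n} (λ i → []-*ˡ (a i) 1# x) ⟨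
    sum (λ i → [ a i ] 1# * x)   ≈⟨ *-distribʳ-sum x (λ i → [ a i ] 1#) ⟨
    sum (λ i → [ a i ] 1#) * x   ∎

  sum-δ : ∀ {n} (u : Fin n) (f : Fin n → Carrier) → sum (λ v → [ ⌊ u ≟ v ⌋ ] (f v)) ≈ f u
  sum-δ {suc n} fzero    f = trans (+-congˡ (sum-replicate-zero n)) (+-identityʳ (f fzero))
  sum-δ {suc n} (fsuc u) f = begin
    0# + sum (λ v → [ ⌊ fsuc u ≟ fsuc v ⌋ ] (f (fsuc v)))
      ≈⟨ +-identityˡ _ ⟩
    sum (λ v → [ ⌊ fsuc u ≟ fsuc v ⌋ ] (f (fsuc v)))
      ≈⟨ sum-cong-≋ {n} (λ v → reflexive (cong (λ b → [ b ] (f (fsuc v))) (suc≟suc u v))) ⟩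
    sum (λ v → [ ⌊ u ≟ v ⌋ ] (f (fsuc v)))
      ≈⟨ sum-δ u (λ v → f (fsuc v)) ⟩
    f (fsuc u) ∎

  sum-omit : ∀ {n} (u : Fin n) (f : Fin n → Carrier) →
             sum (λ v → [ not ⌊ u ≟ v ⌋ ] (f v)) ≈ sum f - f u
  sum-omit {n} u f = begin
    sum (λ v → [ not ⌊ u ≟ v ⌋ ] (f v))
      ≈⟨ //-rightDividesʳ (f u) _ ⟨
    sum (λ v → [ not ⌊ u ≟ v ⌋ ] (f v)) + f u - f u
      ≈⟨ +-congʳ (+-congˡ (sum-δ u f)) ⟨
    sum (λ v → [ not ⌊ u ≟ v ⌋ ] (f v)) + sum (λ v → [ ⌊ u ≟ v ⌋ ] (f v)) - f u
      ≈⟨ +-congʳ (∑-distrib-+ {n} _ _) ⟨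
    sum (λ v → [ not ⌊ u ≟ v ⌋ ] (f v) + [ ⌊ u ≟ v ⌋ ] (f v)) - f u
      ≈⟨ +-congʳ (sum-cong-≋ {n} (λ v → []-split ⌊ u ≟ v ⌋ (f v))) ⟨
    sum f - f u ∎

module NonBacktracking {c ℓ} (R : CommutativeRing c ℓ) {N : ℕ} (G : Digraph N)
    (α : CommutativeRing.Carrier R) (k : ℕ)
    (α*ᾱ≈1 : CommutativeRing._≈_ R (CommutativeRing._*_ R α (Setup.ᾱ R G α k)) (CommutativeRing.1# R))
    where
  open CommutativeRing R
  open Setup R G α k hiding ([_])
  open Digraph G
  open MaskedSums R
  open import Algebra.Properties.Semiring.Sum semiring using (sum-cong-≋; ∑-distrib-+; *-distribˡ-sum)
  open import Algebra.Properties.Ring ring using (-0#≈0#; -1*x≈-x; [y-z]x≈yx-zx)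
  open import Relation.Binary.Reasoning.Setoid setoid

  ∑-cong : {f g : V → Carrier} → (∀ v → f v ≈ g v) → ∑ f ≈ ∑ g
  ∑-cong = sum-cong-≋ {N}

  -- lam u v and Aα u v are these applied to (edge u v) (edge v u)
  weight : Bool → Bool → Carrier
  weight a b = if a ∧ b then 1# else if a ∧ not b then α else ᾱ

  maskedWeight : Bool → Bool → Carrier
  maskedWeight a b = if a ∧ b then 1# else if a ∧ not b then α else if b ∧ not a then ᾱ else 0#

  gout-summand : ∀ a b x → [ a ∧ b ] x + (α * [ a ∧ not b ] x + ᾱ * [ b ∧ not a ] x)
                           ≈ [ a ∨ b ] (weight a b * x)
  gout-summand true  true  x = trans (+-congˡ (trans (+-cong (zeroʳ α) (zeroʳ ᾱ)) (+-identityˡ 0#)))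
                                     (trans (+-identityʳ x) (sym (*-identityˡ x)))
  gout-summand true  false x = trans (+-identityˡ _) (trans (+-congˡ (zeroʳ ᾱ)) (+-identityʳ _))
  gout-summand false true  x = trans (+-identityˡ _) (trans (+-congʳ (zeroʳ α)) (+-identityˡ _))
  gout-summand false false x = trans (+-identityˡ _) (trans (+-cong (zeroʳ α) (zeroʳ ᾱ)) (+-identityˡ 0#))

  gout-as-sum : ∀ f u → gout f u ≈ ∑ (λ v → [ adjU u v ] (lam u v * f u v))
  gout-as-sum f u = begin
    gout f u
      ≈⟨ +-congˡ (+-cong (*-distribˡ-sum {N} α _) (*-distribˡ-sum {N} ᾱ _)) ⟩
    ∑ (λ v → [ bi u v ] (f u v)) + (∑ (λ v → α * [ to u v ] (f u v)) + ∑ (λ v → ᾱ * [ from u v ] (f u v)))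
      ≈⟨ +-congˡ (∑-distrib-+ {N} _ _) ⟨
    ∑ (λ v → [ bi u v ] (f u v)) + ∑ (λ v → α * [ to u v ] (f u v) + ᾱ * [ from u v ] (f u v))
      ≈⟨ ∑-distrib-+ {N} _ _ ⟨
    ∑ (λ v → [ bi u v ] (f u v) + (α * [ to u v ] (f u v) + ᾱ * [ from u v ] (f u v)))
      ≈⟨ ∑-cong (λ v → gout-summand (edge u v) (edge v u) (f u v)) ⟩
    ∑ (λ v → [ adjU u v ] (lam u v * f u v)) ∎

  Bα·-entry : ∀ g v u → Bα· g v u ≈ gout g u - [ adjU u v ] (lam u v * g u v)
  Bα·-entry g v u = begin
    Bα· g v u
      ≈⟨ ∑-cong (λ x → ∑-cong (λ w → []-∧-* (adjU x w) ⌊ u ≟ x ⌋ (not ⌊ v ≟ w ⌋) (h x w))) ⟩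
    ∑ (λ x → ∑ (λ w → [ ⌊ u ≟ x ⌋ ] ([ not ⌊ v ≟ w ⌋ ] ([ adjU x w ] (h x w)))))
      ≈⟨ ∑-cong (λ x → sum-[] {N} ⌊ u ≟ x ⌋ _) ⟩
    ∑ (λ x → [ ⌊ u ≟ x ⌋ ] (∑ (λ w → [ not ⌊ v ≟ w ⌋ ] ([ adjU x w ] (h x w)))))
      ≈⟨ sum-δ u (λ x → ∑ (λ w → [ not ⌊ v ≟ w ⌋ ] ([ adjU x w ] (h x w)))) ⟩
    ∑ (λ w → [ not ⌊ v ≟ w ⌋ ] ([ adjU u w ] (h u w)))
      ≈⟨ sum-omit v (λ w → [ adjU u w ] (h u w)) ⟩
    ∑ (λ w → [ adjU u w ] (h u w)) - [ adjU u v ] (h u v)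
      ≈⟨ +-congʳ (gout-as-sum g u) ⟨
    gout g u - [ adjU u v ] (h u v) ∎
    where
    h : V → V → Carrier
    h x w = lam x w * g x w

  gin-Bα· : ∀ g u → gin (Bα· g) u ≈ (deg u - 1#) * gout g u
  gin-Bα· g u = begin
    gin (Bα· g) u
      ≈⟨ ∑-cong (λ v → []-cong (adjU u v) (Bα·-entry g v u)) ⟩
    ∑ (λ v → [ adjU u v ] (gout g u - [ adjU u v ] (lam u v * g u v)))
      ≈⟨ ∑-cong (λ v → []-sub-[] (adjU u v) (gout g u) (lam u v * g u v)) ⟩
    ∑ (λ v → [ adjU u v ] (gout g u) - [ adjU u v ] (lam u v * g u v))
      ≈⟨ sum-sub {N} _ _ ⟩
    ∑ (λ v → [ adjU u v ] (gout g u)) - ∑ (λ v → [ adjU u v ] (lam u v * g u v))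
      ≈⟨ +-cong (sum-[]-const (adjU u) (gout g u)) (-‿cong (sym (gout-as-sum g u))) ⟩
    deg u * gout g u - gout g u
      ≈⟨ +-congˡ (-‿cong (*-identityˡ (gout g u))) ⟨
    deg u * gout g u - 1# * gout g u
      ≈⟨ [y-z]x≈yx-zx (gout g u) (deg u) 1# ⟨
    (deg u - 1#) * gout g u ∎

  weight-backtrack : ∀ a b X y → [ a ∨ b ] (weight a b * (X - [ b ∨ a ] (weight b a * y)))
                                  ≈ maskedWeight a b * X - [ a ∨ b ] y
  weight-backtrack true  true  X y = *-cancel-inverse X y (*-identityˡ 1#)
  weight-backtrack true  false X y = *-cancel-inverse X y α*ᾱ≈1
  weight-backtrack false true  X y = *-cancel-inverse X y (trans (*-comm ᾱ α) α*ᾱ≈1)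
  weight-backtrack false false X y = sym (trans (+-cong (zeroˡ X) -0#≈0#) (+-identityʳ 0#))

  gout-Bα· : ∀ g u → gout (Bα· g) u ≈ (Aα · gout g) u - gin g u
  gout-Bα· g u = begin
    gout (Bα· g) u
      ≈⟨ gout-as-sum (Bα· g) u ⟩
    ∑ (λ v → [ adjU u v ] (lam u v * Bα· g u v))
      ≈⟨ ∑-cong (λ v → []-cong (adjU u v) (*-congˡ (Bα·-entry g u v))) ⟩
    ∑ (λ v → [ adjU u v ] (lam u v * (gout g v - [ adjU v u ] (lam v u * g v u))))
      ≈⟨ ∑-cong (λ v → weight-backtrack (edge u v) (edge v u) (gout g v) (g v u)) ⟩
    ∑ (λ v → Aα u v * gout g v - [ adjU u v ] (g v u))
      ≈⟨ sum-sub {N} _ _ ⟩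
    (Aα · gout g) u - gin g u ∎

  ·-diagonal : (M : V → V → Carrier) (d : V → Carrier) → (∀ u v → M u v ≈ [ ⌊ u ≟ v ⌋ ] (d u)) →
               ∀ x u → (M · x) u ≈ d u * x u
  ·-diagonal M d M≈diag x u = begin
    ∑ (λ v → M u v * x v)
      ≈⟨ ∑-cong (λ v → trans (*-congʳ (M≈diag u v)) ([]-*ˡ ⌊ u ≟ v ⌋ (d u) (x v))) ⟩
    ∑ (λ v → [ ⌊ u ≟ v ⌋ ] (d u * x v))
      ≈⟨ sum-δ u (λ v → d u * x v) ⟩
    d u * x u ∎

  negI· : ∀ x u → (negI · x) u ≈ - x u
  negI· x u = trans (·-diagonal negI (λ _ → - 1#) (λ u v → -[] ⌊ u ≟ v ⌋ 1#) x u) (-1*x≈-x (x u))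

  D-I· : ∀ x u → (D-I · x) u ≈ (deg u - 1#) * x u
  D-I· = ·-diagonal D-I (λ u → deg u - 1#) (λ u v → sym ([]-‿distrib ⌊ u ≟ v ⌋ (deg u) 1#))

  Z· : ∀ x u → (Z · x) u ≈ 0#
  Z· x u = trans (·-diagonal Z (λ _ → 0#) (λ u v → sym ([]-zero ⌊ u ≟ v ⌋)) x u) (zeroˡ (x u))

theorem1 : ∀ {c ℓ : Level} (R : CommutativeRing c ℓ) {N : ℕ} (G : Digraph N)
             (α : CommutativeRing.Carrier R) (k : ℕ) →
             k ≥ 1 → CommutativeRing._≈_ R (pow R α k) (CommutativeRing.1# R) →
             let open CommutativeRing R
                 open Setup R G α k
             in ∀ (g : EVec) (u : V) →
                  (gout (Bα· g) u ≈ ((Aα · gout g) u + (negI · gin g) u))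
                  × (gin (Bα· g) u ≈ ((D-I · gout g) u + (Z · gin g) u))
theorem1 R G α (suc k) (s≤s z≤n) α^k≈1 g u = out-row , in-row
  where
  open CommutativeRing R
  open Setup R G α (suc k) using (gout; gin; Bα·; Aα; negI; D-I; Z; _·_)
  -- α ^ (suc k) unfolds to α * ᾱ
  open NonBacktracking R G α (suc k) α^k≈1

  out-row : gout (Bα· g) u ≈ (Aα · gout g) u + (negI · gin g) u
  out-row = trans (gout-Bα· g u) (+-congˡ (sym (negI· (gin g) u)))

  in-row : gin (Bα· g) u ≈ (D-I · gout g) u + (Z · gin g) u
  in-row = trans (gin-Bα· g u) (sym (trans (+-cong (D-I· (gout g) u) (Z· (gin g) u)) (+-identityʳ _)))
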